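{- Let $\mathcal F$ be a group pair with $U$ and $A$ as in the context. For each $x\in I$ the following conditions are equivalent: (i) the identity relation $\mathrm{id}_{G_x}=\{(g,g):g\in G_x\}$ belongs to $A$; (ii) $R_{xx,0}=\mathrm{id}_{G_x}$; (iii) $\varphi_{xx}$ is the identity automorphism of $G_x/\{e_x\}$. Consequently, $A$ contains the identity relation $\mathrm{id}_U$ on $U$ if and only if (iii) holds for every $x\in I$.
   Context: A group pair $\mathcal F=(\langle G_x:x\in I\rangle,\langle\varphi_{xy}:(x,y)\in\mathcal E\rangle)$ consists of the following data. - A system of pairwise disjoint groups $G_x$ ($x\in I$), with operation $\circ$ and identity $e_x$. - An equivalence relation $\mathcal E$ on $I$. - For each $(x,y)\in\mathcal E$, a group isomorphism $\varphi_{xy}$ from $G_x/H_{xy}$ onto $G_y/K_{xy}$, where $H_{xy}\trianglelefteq G_x$ and $K_{xy}\trianglelefteq G_y$. Write $X\circ Y=\{a\circ b:a\in X,b\in Y\}$. For each $(x,y)\in\mathcal E$ fix an enumeration without repetitions $\langle H_{xy,\gamma}:\gamma<\kappa_{xy}\rangle$ of the cosets of $H_{xy}$ in $G_x$, with $H_{xy,0}=H_{xy}$, and put $K_{xy,\gamma}=\varphi_{xy}(H_{xy,\gamma})$. Define: - $R_{xy,\alpha}=\bigcup_{\gamma<\kappa_{xy}}H_{xy,\gamma}\times(K_{xy,\gamma}\circ K_{xy,\alpha})$; - $U=\bigcup_{x\in I}G_x$; - $A$ = the set of all unions of subfamilies of $\{R_{xy,\alpha}:(x,y)\in\mathcal E,\alpha<\kappa_{xy}\}$.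 -}

module Defs where

open import Level using (Level; _⊔_; suc)
open import Algebra.Bundles using (Group)
open import Relation.Binary.Core using (Rel)
open import Relation.Binary.Structures using (IsEquivalence)
open import Relation.Binary.PropositionalEquality using (_≡_)
open import Data.Product using (Σ; ∃; _×_; _,_)
open import Function.Bundles using (_⇔_)

record NormalSubgroup {c ℓ} (G : Group c ℓ) (p : Level) : Set (c ⊔ ℓ ⊔ suc p) where
  open Group G
  field
    _∈H     : Carrier → Set p
    ∈-resp  : ∀ {a b} → a ≈ b → a ∈H → b ∈H
    ε∈      : ε ∈H
    ∙∈      : ∀ {a b} → a ∈H → b ∈H → (a ∙ b) ∈H
    ⁻¹∈     : ∀ {a} → a ∈H → (a ⁻¹) ∈H
    normal  : ∀ g {a} → a ∈H → ((g ∙ a) ∙ g ⁻¹) ∈H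

  -- a and b lie in the same coset of H  (i.e. equality in G/H)
  _~_ : Carrier → Carrier → Set p
  a ~ b = ((a ⁻¹) ∙ b) ∈H

  Trivial : Set (c ⊔ ℓ ⊔ p)
  Trivial = ∀ a → a ∈H → a ≈ ε

-- An isomorphism G/H ≅ G'/K, presented (since Agda has no quotient
-- types) by a map on representatives f : G → G' which is well defined,
-- a homomorphism, injective and surjective modulo H and K.

record QuotIso {c ℓ p} (G G' : Group c ℓ)
               (H : NormalSubgroup G p) (K : NormalSubgroup G' p)
               : Set (c ⊔ ℓ ⊔ p) where
  private
    module G  = Group G
    module G' = Group G'
    module H  = NormalSubgroup H
    module K  = NormalSubgroup K
  field
    f         : G.Carrier → G'.Carrier
    well-def  : ∀ {a b} → a H.~ b → f a K.~ f b
    hom       : ∀ a b → f (a G.∙ b) K.~ (f a G'.∙ f b)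
    injective : ∀ {a b} → f a K.~ f b → a H.~ b
    surjective : ∀ b → ∃ λ a → f a K.~ b

record GroupPair (i e c ℓ p : Level) : Set (suc (i ⊔ e ⊔ c ⊔ ℓ ⊔ p)) where
  field
    I        : Set i
    G        : I → Group c ℓ
    E        : Rel I e
    E-equiv  : IsEquivalence E
    -- E is a relation in the set-theoretic sense: at most one proof per pair,
    -- so the data below depend only on the pair (x , y)
    E-irrelevant : ∀ {x y} (r s : E x y) → r ≡ s
    H        : ∀ {x y} → E x y → NormalSubgroup (G x) p
    K        : ∀ {x y} → E x y → NormalSubgroup (G y) p
    φ        : ∀ {x y} (r : E x y) → QuotIso (G x) (G y) (H r) (K r)

  module Gr (x : I) = Group (G x)

  -- the union U of all G_x (disjointness is built into the Σ-type)
  U : Set (i ⊔ c)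
  U = Σ I Gr.Carrier

  Relation : Set (suc (i ⊔ e ⊔ c ⊔ ℓ ⊔ p))
  Relation = U → U → Set (i ⊔ e ⊔ c ⊔ ℓ ⊔ p)

  _≐_ : Relation → Relation → Set (i ⊔ e ⊔ c ⊔ ℓ ⊔ p)
  S ≐ T = ∀ u v → S u v ⇔ T u v

  -- R_{xy,α}: the coset H_{xy,α} is represented by any a ∈ G_x lying in it,
  -- so K_{xy,α} = φ_{xy}(H_{xy,α}) is the K_{xy}-coset of f a, and
  -- K_{xy,γ} ∘ K_{xy,α} is the K_{xy}-coset of f g ∙ f a for g ∈ H_{xy,γ}.
  data R {x y : I} (r : E x y) (a : Gr.Carrier x) : Relation where
    mk : (g : Gr.Carrier x) (h : Gr.Carrier y) →
         NormalSubgroup._~_ (K r) h (Gr._∙_ y (QuotIso.f (φ r) g) (QuotIso.f (φ r) a)) →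
         R r a (x , g) (y , h)

  -- R_{xy,0}: index 0 is the coset H_{xy} itself, represented by e_x
  R₀ : {x y : I} (r : E x y) → Relation
  R₀ {x} r = R r (Gr.ε x)

  -- membership in A: S is the union of a subfamily of the R_{xy,α}
  InA : Relation → Set (suc (i ⊔ e ⊔ c ⊔ ℓ ⊔ p))
  InA S = Σ ((x y : I) → E x y → Gr.Carrier x → Set (i ⊔ e ⊔ c ⊔ ℓ ⊔ p)) λ P →
            S ≐ (λ u v → Σ I λ x → Σ I λ y → Σ (E x y) λ r → Σ (Gr.Carrier x) λ a →
                           P x y r a × R r a u v)

  data IdG (x : I) : Relation where
    mk : (g g' : Gr.Carrier x) → Gr._≈_ x g g' → IdG x (x , g) (x , g')

  data IdU : Relation where
    mk : (x : I) (g g' : Gr.Carrier x) → Gr._≈_ x g g' → IdU (x , g) (x , g')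

  reflE : ∀ x → E x x
  reflE x = IsEquivalence.refl E-equiv {x}

  PhiId : I → Set (c ⊔ ℓ ⊔ p)
  PhiId x = NormalSubgroup.Trivial (H (reflE x)) × NormalSubgroup.Trivial (K (reflE x))
            × (∀ g → Gr._≈_ x (QuotIso.f (φ (reflE x)) g) g)

module Submission where

-- Everything rests on one observation about a single relation R_{xy,α}.
-- Represent the coset H_{xy,α} by a ∈ G_x.  If φ(a) ∈ K_{xy} (for instance
-- a = e_x, i.e. α = 0), then R_{xy,α} is exactly the graph of φ_{xy} modulo
-- K_{xy}, the relation  h ∈ φ(g) K_{xy}.  Consequently:
--   (ii) ⇔ (iii)  R_{xx,0} = id_{G_x} says that g is the only element of
--                 φ(g) K_{xx}; this forces K = H = {e_x} and φ = id.
--   (i) ⇒ (iii)   If a union of R's is contained in id_{G_x} and contains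
--                 (e_x, e_x), the member containing (e_x, e_x) is some R_{xx,α}
--                 with φ(a) ∈ K, i.e. the graph of φ_{xx} mod K, so the graph
--                 lies in id_{G_x}; that suffices for (iii).
--   (ii) ⇒ (i)    id_{G_x} = R_{xx,0} is itself a member of A.
-- The statement about id_U is the same argument applied to id_U = ⋃_x id_{G_x}.

open import Defs
open import Level using (Level; Lift; lift; _⊔_)
open import Data.Product using (_×_; Σ; _,_)
open import Data.Unit.Polymorphic using (⊤)
open import Function.Bundles using (_⇔_; mk⇔; Equivalence)
open import Function.Properties.Equivalence using () renaming (sym to ⇔-sym; trans to ⇔-trans)
open import Algebra.Bundles using (Group)
open import Relation.Binary.PropositionalEquality using (_≡_; refl)
import Algebra.Properties.Group as GroupProperties

open Equivalence

-- Congruence modulo a normal subgroup N:  a ~ b  iff  a⁻¹ ∙ b ∈ N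
-- (note that a⁻¹ ∙ b is, by definition, the left division a \\ b).
module Cosets {c ℓ p} (G : Group c ℓ) (N : NormalSubgroup G p) where
  open Group G
  open NormalSubgroup N
  open GroupProperties G

  ~-refl : ∀ a → a ~ a
  ~-refl a = ∈-resp (sym (inverseˡ a)) ε∈

  ≈⇒~ : ∀ {a b} → a ≈ b → a ~ b
  ≈⇒~ {a} a≈b = ∈-resp (∙-congˡ a≈b) (~-refl a)

  ~-sym : ∀ {a b} → a ~ b → b ~ a
  ~-sym {a} {b} a~b = ∈-resp (⁻¹-anti-homo-\\ a b) (⁻¹∈ a~b)

  ~-trans : ∀ {a b d} → a ~ b → b ~ d → a ~ d
  ~-trans {a} {b} {d} a~b b~d =
    ∈-resp (trans (assoc _ _ _) (∙-congˡ (\\-leftDividesˡ b d))) (∙∈ a~b b~d)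

  ~-∙-member : ∀ {k} a → k ∈H → a ~ (a ∙ k)
  ~-∙-member {k} a k∈N = ∈-resp (sym (\\-leftDividesʳ a k)) k∈N

  ~-∙⇒member : ∀ {a k} → a ~ (a ∙ k) → k ∈H
  ~-∙⇒member {a} {k} = ∈-resp (\\-leftDividesʳ a k)

  ε~⇒member : ∀ {b} → ε ~ b → b ∈H
  ε~⇒member {b} = ∈-resp (trans (∙-congʳ ε⁻¹≈ε) (identityˡ b))

  member-cancelˡ : ∀ {a k} → a ∈H → (a ∙ k) ∈H → k ∈H
  member-cancelˡ {a} {k} a∈N ak∈N =
    ∈-resp (\\-leftDividesʳ a k) (∙∈ (⁻¹∈ a∈N) ak∈N)

  trivial⇒~⇒≈ : Trivial → ∀ {a b} → a ~ b → a ≈ b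
  trivial⇒~⇒≈ N-trivial a~b = ⁻¹-injective (inverseˡ-unique _ _ (N-trivial _ a~b))

image-of-ε : ∀ {c ℓ p} {G G' : Group c ℓ} {H : NormalSubgroup G p} {K : NormalSubgroup G' p}
             (φ : QuotIso G G' H K) →
             NormalSubgroup._∈H K (QuotIso.f φ (Group.ε G))
image-of-ε {G = G} {H = H} {K = K} φ =
  ~-∙⇒member (~-trans (~-sym (well-def (≈⇒~ᴴ (identityˡ ε)))) (hom ε ε))
  where
  open Group G
  open QuotIso φ
  open Cosets _ K
  open Cosets G H using () renaming (≈⇒~ to ≈⇒~ᴴ)

module Main {i e c ℓ p : Level} (F : GroupPair i e c ℓ p) where
  open GroupPair F

  Lv : Level
  Lv = i ⊔ e ⊔ c ⊔ ℓ ⊔ p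

  f : ∀ {x y} → E x y → Gr.Carrier x → Gr.Carrier y
  f r = QuotIso.f (φ r)

  InKernel : ∀ {x y} (r : E x y) → Gr.Carrier x → Set p
  InKernel r a = NormalSubgroup._∈H (K r) (f r a)

  Graph : ∀ {x y} (r : E x y) → Gr.Carrier x → Gr.Carrier y → Set p
  Graph r g h = NormalSubgroup._~_ (K r) h (f r g)

  module _ {x y : I} (r : E x y) where
    open Cosets (G y) (K r)

    R⇔Graph : ∀ {a} → InKernel r a → ∀ g h → R r a (x , g) (y , h) ⇔ Graph r g h
    R⇔Graph fa∈K g h = mk⇔
      (λ { (mk _ _ h~fgfa) → ~-trans h~fgfa (~-sym (~-∙-member (f r g) fa∈K)) })
      (λ h~fg → mk g h (~-trans h~fg (~-∙-member (f r g) fa∈K)))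

    R₀⇔Graph : ∀ g h → R₀ r (x , g) (y , h) ⇔ Graph r g h
    R₀⇔Graph = R⇔Graph (image-of-ε (φ r))

    unit-pair⇒InKernel : ∀ {a} → R r a (x , Gr.ε x) (y , Gr.ε y) → InKernel r a
    unit-pair⇒InKernel (mk _ _ εy~fεfa) =
      member-cancelˡ (image-of-ε (φ r)) (ε~⇒member εy~fεfa)

  module _ (x : I) where
    private
      r = reflE x
      module Gx = Group (G x)
      module Kx = Cosets (G x) (K r)
      open GroupProperties (G x)

    -- (iii) says that the graph of φ_{xx} mod K is the diagonal ...
    PhiId⇒Graph⇔≈ : PhiId x → ∀ g h → Graph r g h ⇔ Gx._≈_ g h
    PhiId⇒Graph⇔≈ (_ , K-trivial , fg≈g) g h = mk⇔
      (λ h~fg → Gx.sym (Gx.trans (Kx.trivial⇒~⇒≈ K-trivial h~fg) (fg≈g g)))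
      (λ g≈h → Kx.≈⇒~ (Gx.sym (Gx.trans (fg≈g g) g≈h)))

    -- ... and already the inclusion of that graph in the diagonal implies (iii):
    -- φ(g) ∈ φ(g) K gives φ = id; k ∈ K gives k⁻¹ ∈ φ(e) K, so k⁻¹ = e;
    -- and a ∈ H gives φ(a) ~ φ(e) with K trivial, so a = e.
    Graph⊆≈⇒PhiId : (∀ g h → Graph r g h → Gx._≈_ g h) → PhiId x
    Graph⊆≈⇒PhiId graph⊆≈ = H-trivial , K-trivial , fg≈g
      where
      open QuotIso (φ r) using (well-def)
      module Hr = NormalSubgroup (H r)
      module Kr = NormalSubgroup (K r)

      fg≈g : ∀ g → Gx._≈_ (f r g) g
      fg≈g g = Gx.sym (graph⊆≈ g (f r g) (Kx.~-refl _))

      K-trivial : Kr.Trivial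
      K-trivial k k∈K = ⁻¹-injective (Gx.trans (Gx.sym ε≈k⁻¹) (Gx.sym ε⁻¹≈ε))
        where
        ε≈k⁻¹ : Gx._≈_ Gx.ε (k Gx.⁻¹)
        ε≈k⁻¹ = graph⊆≈ Gx.ε (k Gx.⁻¹) (Kr.∈-resp (Gx.sym k⁻¹⁻¹∙fε≈k) k∈K)
          where
          k⁻¹⁻¹∙fε≈k : Gx._≈_ ((k Gx.⁻¹) Gx.⁻¹ Gx.∙ f r Gx.ε) k
          k⁻¹⁻¹∙fε≈k = Gx.trans (Gx.∙-cong (⁻¹-involutive k) (fg≈g Gx.ε)) (Gx.identityʳ k)

      H-trivial : Hr.Trivial
      H-trivial a a∈H = Gx.trans (Gx.sym (fg≈g a)) (Gx.trans fa≈fε (fg≈g Gx.ε))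
        where
        fa≈fε = Kx.trivial⇒~⇒≈ K-trivial
                  (well-def (Hr.∈-resp (Gx.sym (Gx.identityʳ _)) (Hr.⁻¹∈ a∈H)))

    R₀≐IdG⇔PhiId : (R₀ r ≐ IdG x) ⇔ PhiId x
    R₀≐IdG⇔PhiId = mk⇔ ii⇒iii iii⇒ii
      where
      ii⇒iii : R₀ r ≐ IdG x → PhiId x
      ii⇒iii ii = Graph⊆≈⇒PhiId λ g h graph →
        case-IdG (to (ii (x , g) (x , h)) (from (R₀⇔Graph r g h) graph))
        where
        case-IdG : ∀ {g h} → IdG x (x , g) (x , h) → Gx._≈_ g h
        case-IdG (mk _ _ g≈h) = g≈h

      iii⇒ii : PhiId x → R₀ r ≐ IdG x
      iii⇒ii phiId _ _ = mk⇔
        (λ { r₀@(mk g h _) → mk g h (to (graph⇔≈ g h) (to (R₀⇔Graph r g h) r₀)) })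
        (λ { (mk g h g≈h) → from (R₀⇔Graph r g h) (from (graph⇔≈ g h) g≈h) })
        where graph⇔≈ = PhiId⇒Graph⇔≈ phiId

  Family : Set (Level.suc Lv)
  Family = (x y : I) → E x y → Gr.Carrier x → Set Lv

  ⋃ : Family → Relation
  ⋃ P u v = Σ I λ x → Σ I λ y → Σ (E x y) λ r → Σ (Gr.Carrier x) λ a →
              P x y r a × R r a u v

  InA-resp-≐ : ∀ {S T} → S ≐ T → InA S → InA T
  InA-resp-≐ S≐T (P , S≐⋃P) = P , λ u v → ⇔-trans (⇔-sym (S≐T u v)) (S≐⋃P u v)

  -- (i) ⇒ (iii), for any S ∈ A that contains (e_x, e_x) and relates elements
  -- of G_x only to equal ones: the member of the union through (e_x, e_x) is
  -- the graph of φ_{xx} mod K, which is therefore contained in the diagonal.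
  InA⇒PhiId : ∀ {S} x → InA S → S (x , Gr.ε x) (x , Gr.ε x) →
              (∀ g h → S (x , g) (x , h) → Gr._≈_ x g h) → PhiId x
  InA⇒PhiId {S} x (P , S≐⋃P) Sεε S⊆≈ = through (to (S≐⋃P _ _) Sεε)
    where
    through : ⋃ P (x , Gr.ε x) (x , Gr.ε x) → PhiId x
    through (_ , _ , r , a , Pa , rel@(mk _ _ _)) with E-irrelevant r (reflE x)
    ... | refl = Graph⊆≈⇒PhiId x λ g h graph →
      S⊆≈ g h (from (S≐⋃P _ _)
        (x , x , reflE x , a , Pa , from (R⇔Graph r (unit-pair⇒InKernel r rel) g h) graph))

  -- id on ⋃ {G_z : Q z}; both id_{G_x} and id_U are of this form.
  IdOn : (I → Set i) → Relation
  IdOn Q u v = Σ I λ z → Q z × IdG z u v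

  IdG≐IdOn : ∀ x → IdG x ≐ IdOn (_≡ x)
  IdG≐IdOn x _ _ = mk⇔ (λ idg → x , refl , idg) (λ { (_ , refl , idg) → idg })

  IdU≐IdOn : IdU ≐ IdOn (λ _ → ⊤)
  IdU≐IdOn _ _ = mk⇔ (λ { (mk z g g' g≈g') → z , _ , mk g g' g≈g' })
                     (λ { (z , _ , mk g g' g≈g') → mk z g g' g≈g' })

  Index : Set (i ⊔ e ⊔ c)
  Index = Σ I λ x → Σ I λ y → E x y × Gr.Carrier x

  IdOn∈A : ∀ Q → (∀ z → Q z → R₀ (reflE z) ≐ IdG z) → InA (IdOn Q)
  IdOn∈A Q R₀≐IdG = P , λ u v → mk⇔
    (λ { (z , Qz , idg) →
           z , z , reflE z , Gr.ε z , lift (z , Qz , refl) , from (R₀≐IdG z Qz u v) idg })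
    (λ { (_ , _ , _ , _ , lift (z , Qz , refl) , r₀) → z , Qz , to (R₀≐IdG z Qz u v) r₀ })
    where
    P : Family
    P x y r a = Lift Lv (Σ I λ z → Q z ×
                  _≡_ {A = Index} (x , y , r , a) (z , z , reflE z , Gr.ε z))

  IdG∈A⇔R₀≐IdG : ∀ x → InA (IdG x) ⇔ (R₀ (reflE x) ≐ IdG x)
  IdG∈A⇔R₀≐IdG x = mk⇔
    (λ idG∈A → from (R₀≐IdG⇔PhiId x)
       (InA⇒PhiId x idG∈A (mk _ _ (Gr.refl x)) λ { _ _ (mk _ _ g≈h) → g≈h }))
    (λ R₀≐IdG → InA-resp-≐ (λ u v → ⇔-sym (IdG≐IdOn x u v))
       (IdOn∈A (_≡ x) λ { _ refl → R₀≐IdG }))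

  IdU∈A⇔PhiId : InA IdU ⇔ (∀ x → PhiId x)
  IdU∈A⇔PhiId = mk⇔
    (λ idU∈A x →
       InA⇒PhiId x idU∈A (mk x _ _ (Gr.refl x)) λ { _ _ (mk _ _ _ g≈h) → g≈h })
    (λ phiId → InA-resp-≐ (λ u v → ⇔-sym (IdU≐IdOn u v))
       (IdOn∈A _ λ z _ → from (R₀≐IdG⇔PhiId z) (phiId z)))

theorem3p4 : ∀ {i e c ℓ p : Level} (F : GroupPair i e c ℓ p) → let open GroupPair F in
    (∀ x → (InA (IdG x) ⇔ (R₀ (reflE x) ≐ IdG x)) × ((R₀ (reflE x) ≐ IdG x) ⇔ PhiId x))
    × (InA IdU ⇔ (∀ x → PhiId x))
theorem3p4 F = (λ x → IdG∈A⇔R₀≐IdG x , R₀≐IdG⇔PhiId x) , IdU∈A⇔PhiId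
  where open Main F
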